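{- Let $N$ be a level-1 network on $X$ with cycles $C_1,\ldots,C_k$, $k\geq 1$. Then $\mathcal H_N=\{R(C_1),\ldots,R(C_k)\}$ is a hierarchy on $X$, i.e. $A\cap B\in\{A,B,\emptyset\}$ for all $A,B\in\mathcal H_N$.
   Context: $X$ is a finite set with $|X|\ge 3$. Directed graphs have no loops/multiple edges. A rooted DAG has a unique indegree-$0$ vertex (root). Leaves: indegree $1$, outdegree $0$; interior vertices: non-leaves; hybrid vertices: indegree $2$, nonzero outdegree. A cycle of a DAG is an induced subgraph whose underlying undirected graph is a cycle. A phylogenetic network on $X$: rooted DAG, no vertex of indegree and outdegree $1$, leaf set $X$; it is level-1 if each interior vertex lies in at most one cycle. For a cycle $C$ of a level-1 network, $r(C)$ is the unique vertex of $C$ both of whose children lie in $C$, and $R(C)$ is the set of leaves reachable from $r(C)$ by a directed path. -}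

module Defs where

open import Data.Nat using (ℕ; zero; suc; _+_; _≡ᵇ_)
open import Data.Nat.DivMod using (_%_)
open import Data.Fin using (Fin; toℕ)
import Data.Fin as F
open import Data.Bool using (Bool; true; false; T; if_then_else_)
open import Data.Product using (Σ; Σ-syntax; ∃; _×_; _,_)
open import Data.Sum using (_⊎_)
open import Relation.Nullary using (¬_)
open import Relation.Binary.PropositionalEquality using (_≡_; _≢_)

-- A directed graph (no multiple edges) on vertex set Fin n, given by a
-- Boolean adjacency matrix: G u v = true iff there is an edge u → v.
Graph : ℕ → Set
Graph n = Fin n → Fin n → Bool

module _ {n : ℕ} (G : Graph n) where

  Edge : Fin n → Fin n → Set
  Edge u v = T (G u v)

  Adj : Fin n → Fin n → Set
  Adj u v = Edge u v ⊎ Edge v u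

count : ∀ {m} → (Fin m → Bool) → ℕ
count {zero}  f = 0
count {suc m} f = (if f F.zero then 1 else 0) + count (λ i → f (F.suc i))

module _ {n : ℕ} (G : Graph n) where

  indeg : Fin n → ℕ
  indeg v = count (λ u → G u v)

  outdeg : Fin n → ℕ
  outdeg v = count (λ w → G v w)

  data Reach : Fin n → Fin n → Set where
    here : ∀ {v} → Reach v v
    step : ∀ {u w v} → Edge G u w → Reach w v → Reach u v

  IsLeaf : Fin n → Set
  IsLeaf v = (indeg v ≡ 1) × (outdeg v ≡ 0)

  Interior : Fin n → Set
  Interior v = ¬ IsLeaf v

  -- Phylogenetic network; the leaf set X is the set of leaves of G,
  -- and |X| ≥ 3 is expressed by three pairwise distinct leaves.
  record PhyloNetwork : Set where
    field
      noLoops   : ∀ v → ¬ Edge G v v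
      acyclic   : ∀ u v → Edge G u v → ¬ Reach v u
      root      : Fin n
      rootIndeg : indeg root ≡ 0
      rootUniq  : ∀ v → indeg v ≡ 0 → v ≡ root
      noDeg11   : ∀ v → ¬ ((indeg v ≡ 1) × (outdeg v ≡ 1))
      x₁ x₂ x₃  : Fin n
      leaf₁     : IsLeaf x₁
      leaf₂     : IsLeaf x₂
      leaf₃     : IsLeaf x₃
      dist₁₂    : x₁ ≢ x₂
      dist₁₃    : x₁ ≢ x₃
      dist₂₃    : x₂ ≢ x₃

CycNb : (k : ℕ) → Fin (3 + k) → Fin (3 + k) → Set
CycNb k i j = (toℕ j ≡ suc (toℕ i) % (3 + k)) ⊎ (toℕ i ≡ suc (toℕ j) % (3 + k))

module _ {n : ℕ} (G : Graph n) where

  -- A cycle of G: an induced subgraph whose underlying undirected graph is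
  -- a cycle, given by an injective enumeration vtx of its vertices such that
  -- two of them are adjacent in G (either direction) iff they are
  -- consecutive in the cyclic order.
  record Cycle : Set where
    field
      k     : ℕ
      vtx   : Fin (3 + k) → Fin n
      inj   : ∀ i j → vtx i ≡ vtx j → i ≡ j
      adj⇒nb : ∀ i j → Adj G (vtx i) (vtx j) → CycNb k i j
      nb⇒adj : ∀ i j → CycNb k i j → Adj G (vtx i) (vtx j)

  _∈C_ : Fin n → Cycle → Set
  v ∈C C = Σ[ i ∈ Fin (3 + Cycle.k C) ] Cycle.vtx C i ≡ v

  -- level-1: every interior vertex lies in at most one cycle
  -- (cycles being identified by their vertex sets)
  Level1 : Set
  Level1 = ∀ (C D : Cycle) v → Interior G v → v ∈C C → v ∈C D →
           ∀ w → (w ∈C C → w ∈C D) × (w ∈C D → w ∈C C)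

  IsCycleRoot : Cycle → Fin n → Set
  IsCycleRoot C v = (v ∈C C) × (Σ[ w₁ ∈ Fin n ] Σ[ w₂ ∈ Fin n ]
      (w₁ ≢ w₂) × Edge G v w₁ × Edge G v w₂ × (w₁ ∈C C) × (w₂ ∈C C))

  R : Cycle → Fin n → Set
  R C x = IsLeaf G x × (Σ[ r ∈ Fin n ] IsCycleRoot C r × Reach G r x)

Cap∈ : ∀ {n} → (Fin n → Set) → (Fin n → Set) → Set
Cap∈ A B =
    (∀ x → ((A x × B x) → A x) × (A x → (A x × B x)))
  ⊎ (∀ x → ((A x × B x) → B x) × (B x → (A x × B x)))
  ⊎ (∀ x → ¬ (A x × B x))

-- Level-1 makes a cycle C rigid: a chordless circuit (simple closed undirected walk of
-- length ≥ 3) is itself a cycle, hence equals C as soon as it meets C in an interior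
-- vertex, and a circuit with a chord splits into two shorter circuits sharing the chord;
-- so every circuit meeting C lies inside C.  In particular no path leaves C and returns
-- to it.  This forces r(C) to be the only vertex of C with both children in C, and makes
-- r(C) comparable with every vertex v sharing a descendant with it: otherwise climbing
-- from r(C) and v to a maximal common ancestor and descending to a minimal common
-- descendant gives a circuit through r(C) and a parent of r(C), which is not in C.
-- Hence R(D) ⊆ R(C) if a root of C lies above a root of D, symmetrically, and
-- R(C) ∩ R(D) = ∅ otherwise.

module Submission where

open import Defs
open import Data.Bool using (Bool; true; false; T)
open import Data.Empty using (⊥; ⊥-elim)
open import Data.Fin using (Fin; zero; suc; toℕ; fromℕ<; _≟_)
open import Data.Fin.Properties using (toℕ<n; toℕ-injective; toℕ-fromℕ<; any?; injective⇒≤)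
open import Data.List using (List; []; _∷_; _++_; [_]; length; lookup; applyUpTo)
open import Data.List.Properties using (++-assoc; length-++)
open import Data.List.Membership.Propositional using (_∈_)
open import Data.List.Membership.Propositional.Properties
  using (∈-lookup; ∈-++⁺ˡ; ∈-++⁺ʳ; ∈-++⁻; ∈-∃++; ∈-applyUpTo⁺; ∈-applyUpTo⁻)
open import Data.List.Relation.Unary.All as All using (All; []; _∷_)
import Data.List.Relation.Unary.All.Properties as All
open import Data.List.Relation.Unary.Any using (here; there; index)
open import Data.List.Relation.Unary.Any.Properties using (lookup-index)
open import Data.List.Relation.Unary.Unique.Propositional using (Unique; []; _∷_)
import Data.List.Relation.Unary.Unique.Propositional.Properties as Unique
open import Data.List.Relation.Binary.Permutation.Propositional
  using (_↭_; ↭⇒↭ₛ; ↭-prep; ↭-trans; ↭-sym; ↭-reflexive)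
open import Data.List.Relation.Binary.Permutation.Propositional.Properties
  using (++-comm; ++⁺ˡ; ++⁺ʳ; ↭-length; ∈-resp-↭)
import Data.List.Relation.Binary.Permutation.Setoid.Properties as ↭ₛ
open import Data.Nat as ℕ using (ℕ; zero; suc; _+_; _≤_; _<_; s≤s; z≤n)
open import Data.Nat.DivMod using (_%_; n%n≡0; m%n<n; m<n⇒m%n≡m)
open import Data.Nat.Properties
  using ( suc-injective; 1+n≢0; ≤∧≢⇒<; <-irrefl; <-cmp; ≤-pred; ≤-<-trans; ≤-refl; ≤-trans
        ; ≤-reflexive; <⇒≤; <⇒≱; +-identityʳ; +-comm; +-assoc; +-monoˡ-≤; +-monoʳ-≤; m<m+n)
open import Data.Product using (∃-syntax; _×_; _,_; proj₁; proj₂)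
open import Data.Unit using (⊤; tt)
open import Function using (_∘_)
open import Data.Sum using (_⊎_; inj₁; inj₂; [_,_]′; swap)
open import Relation.Binary.Definitions using (_Respects_; tri<; tri≈; tri>)
open import Relation.Binary.PropositionalEquality
  using (_≡_; _≢_; refl; sym; trans; cong; subst; subst₂; setoid; ≢-sym)
open import Relation.Nullary using (¬_; Dec; yes; no)
open import Relation.Nullary.Decidable using (map′; _×-dec_; _⊎-dec_; ¬?; T?; decidable-stable)

module _ {A : Set} where

  Unique-++⁻ˡ : ∀ xs {ys : List A} → Unique (xs ++ ys) → Unique xs
  Unique-++⁻ˡ []       _          = []
  Unique-++⁻ˡ (x ∷ xs) (x∉ ∷ xs!) = All.++⁻ˡ xs x∉ ∷ Unique-++⁻ˡ xs xs!

  Unique-++⁻ʳ : ∀ xs {ys : List A} → Unique (xs ++ ys) → Unique ys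
  Unique-++⁻ʳ []       ys!       = ys!
  Unique-++⁻ʳ (x ∷ xs) (_ ∷ xs!) = Unique-++⁻ʳ xs xs!

  Unique-resp-↭ : Unique {A = A} Respects _↭_
  Unique-resp-↭ p = ↭ₛ.Unique-resp-↭ (setoid A) (↭⇒↭ₛ p)

  rotate-↭ : ∀ xs {y : A} ys → xs ++ y ∷ ys ↭ ys ++ xs ++ [ y ]
  rotate-↭ xs {y} ys = ↭-trans (++-comm xs (y ∷ ys))
    (↭-trans (++-comm [ y ] (ys ++ xs)) (↭-reflexive (++-assoc ys xs [ y ])))

  drop-between-↭ : ∀ p {x : A} q {y} s → p ++ x ∷ q ++ y ∷ s ↭ (p ++ x ∷ y ∷ s) ++ q
  drop-between-↭ p {x} q {y} s = ↭-trans (++⁺ˡ p (↭-prep x (++-comm q (y ∷ s))))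
    (↭-reflexive (sym (++-assoc p (x ∷ y ∷ s) q)))

  extract-between-↭ : ∀ p {x : A} q {y} s → p ++ x ∷ q ++ y ∷ s ↭ (x ∷ q ++ [ y ]) ++ p ++ s
  extract-between-↭ p {x} q {y} s = ↭-trans (↭-reflexive regroup)
    (↭-trans (++⁺ʳ s (++-comm p (x ∷ q ++ [ y ]))) (↭-reflexive (++-assoc (x ∷ q ++ [ y ]) p s)))
    where
    regroup : p ++ x ∷ q ++ y ∷ s ≡ (p ++ x ∷ q ++ [ y ]) ++ s
    regroup = trans (cong (λ t → p ++ x ∷ t) (sym (++-assoc q [ y ] s)))
                    (sym (++-assoc p (x ∷ q ++ [ y ]) s))

  last-two : ∀ (x y : A) zs → ∃[ M ] ∃[ u ] ∃[ v ] x ∷ y ∷ zs ≡ M ++ u ∷ v ∷ []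
  last-two x y []       = [] , x , y , refl
  last-two x y (z ∷ zs) = let M , u , v , eq = last-two y z zs in x ∷ M , u , v , cong (x ∷_) eq

  split-at-index : ∀ (xs : List A) j → ∃[ q ] ∃[ s ] xs ≡ q ++ lookup xs j ∷ s × length q ≡ toℕ j
  split-at-index (x ∷ xs) zero    = [] , xs , refl , refl
  split-at-index (x ∷ xs) (suc j) =
    let q , s , eq , len = split-at-index xs j in x ∷ q , s , cong (x ∷_) eq , cong suc len

  split-at-indices : ∀ (xs : List A) {i j} → toℕ i < toℕ j →
    ∃[ p ] ∃[ q ] ∃[ s ] xs ≡ p ++ lookup xs i ∷ q ++ lookup xs j ∷ s ×
                          length p ≡ toℕ i × suc (length p + length q) ≡ toℕ j
  split-at-indices (x ∷ xs) {zero} {suc j} _ =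
    let q , s , eq , len = split-at-index xs j in [] , q , s , cong (x ∷_) eq , refl , cong suc len
  split-at-indices (x ∷ xs) {suc i} {suc j} (s≤s i<j) =
    let p , q , s , eq , len₁ , len₂ = split-at-indices xs i<j
    in x ∷ p , q , s , cong (x ∷_) eq , cong suc len₁ , cong suc len₂

  lookup-injective : ∀ {xs : List A} → Unique xs → ∀ {i j} → lookup xs i ≡ lookup xs j → i ≡ j
  lookup-injective (x∉ ∷ xs!) {zero}  {zero}  _  = refl
  lookup-injective (x∉ ∷ xs!) {zero}  {suc j} eq = ⊥-elim (All.lookup x∉ (∈-lookup j) eq)
  lookup-injective (x∉ ∷ xs!) {suc i} {zero}  eq = ⊥-elim (All.lookup x∉ (∈-lookup i) (sym eq))
  lookup-injective (x∉ ∷ xs!) {suc i} {suc j} eq = cong suc (lookup-injective xs! eq)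

  ∈-pair : ∀ {x a b : A} → x ∈ a ∷ b ∷ [] → x ≡ a ⊎ x ≡ b
  ∈-pair (here eq)         = inj₁ eq
  ∈-pair (there (here eq)) = inj₂ eq

  distinct⇒3≤length : ∀ {xs : List A} {x y z} → x ∈ xs → y ∈ xs → z ∈ xs →
                      x ≢ y → x ≢ z → y ≢ z → 3 ≤ length xs
  distinct⇒3≤length {_ ∷ _ ∷ _ ∷ _} _ _ _ _ _ _ = s≤s (s≤s (s≤s z≤n))
  distinct⇒3≤length {_ ∷ []} (here refl) (here refl) _ x≢y _ _ = ⊥-elim (x≢y refl)
  distinct⇒3≤length {_ ∷ _ ∷ []} x∈ y∈ z∈ x≢y x≢z y≢z
    with ∈-pair x∈ | ∈-pair y∈ | ∈-pair z∈
  ... | inj₁ refl | inj₁ refl | _         = ⊥-elim (x≢y refl)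
  ... | inj₂ refl | inj₂ refl | _         = ⊥-elim (x≢y refl)
  ... | inj₁ refl | inj₂ refl | inj₁ refl = ⊥-elim (x≢z refl)
  ... | inj₁ refl | inj₂ refl | inj₂ refl = ⊥-elim (y≢z refl)
  ... | inj₂ refl | inj₁ refl | inj₁ refl = ⊥-elim (y≢z refl)
  ... | inj₂ refl | inj₁ refl | inj₂ refl = ⊥-elim (x≢z refl)

-- CycNb k i j is definitionally Next k i j ⊎ Next k j i.
Next : (k : ℕ) → Fin (3 + k) → Fin (3 + k) → Set
Next k i j = toℕ j ≡ suc (toℕ i) % (3 + k)

module _ (k : ℕ) where

  CycNb? : ∀ i j → Dec (CycNb k i j)
  CycNb? i j = (toℕ j ℕ.≟ _) ⊎-dec (toℕ i ℕ.≟ _)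

  Next-cases : ∀ {i j} → Next k i j → toℕ j ≡ suc (toℕ i) ⊎ (toℕ i ≡ 2 + k × toℕ j ≡ 0)
  Next-cases {i} {j} next with suc (toℕ i) ℕ.≟ 3 + k
  ... | yes last =
    inj₂ (suc-injective last , trans next (trans (cong (_% (3 + k)) last) (n%n≡0 (3 + k))))
  ... | no ¬last = inj₁ (trans next (m<n⇒m%n≡m (≤∧≢⇒< (toℕ<n i) ¬last)))

  Next-step : ∀ {i j} → toℕ j ≡ suc (toℕ i) → Next k i j
  Next-step {i} {j} j≡1+i = trans j≡1+i (sym (m<n⇒m%n≡m (subst (_< 3 + k) j≡1+i (toℕ<n j))))

  Next-wrap : ∀ {i j} → toℕ i ≡ 2 + k → toℕ j ≡ 0 → Next k i j
  Next-wrap i≡last j≡0 =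
    trans j≡0 (sym (trans (cong (λ t → suc t % (3 + k)) i≡last) (n%n≡0 (3 + k))))

  Next-functional : ∀ {i a b} → Next k i a → Next k i b → a ≡ b
  Next-functional next₁ next₂ = toℕ-injective (trans next₁ (sym next₂))

  Next-injective : ∀ {i a b} → Next k a i → Next k b i → a ≡ b
  Next-injective next₁ next₂ with Next-cases next₁ | Next-cases next₂
  ... | inj₁ e₁       | inj₁ e₂       = toℕ-injective (suc-injective (trans (sym e₁) e₂))
  ... | inj₂ (a≡ , _) | inj₂ (b≡ , _) = toℕ-injective (trans a≡ (sym b≡))
  ... | inj₁ e₁       | inj₂ (_ , e₂) = ⊥-elim (1+n≢0 (trans (sym e₁) e₂))
  ... | inj₂ (_ , e₁) | inj₁ e₂       = ⊥-elim (1+n≢0 (trans (sym e₂) e₁))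

  CycNb-at-most-two : ∀ {i a b c} → CycNb k i a → CycNb k i b → CycNb k i c →
                      a ≢ b → a ≢ c → b ≢ c → ⊥
  CycNb-at-most-two {i} {a} {b} {c} nb₁ nb₂ nb₃ a≢b a≢c b≢c with nb₁ | nb₂ | nb₃
  ... | inj₁ x | inj₁ y | _      = a≢b (Next-functional {i} x y)
  ... | inj₂ x | inj₂ y | _      = a≢b (Next-injective {i} x y)
  ... | inj₁ x | inj₂ y | inj₁ z = a≢c (Next-functional {i} x z)
  ... | inj₁ x | inj₂ y | inj₂ z = b≢c (Next-injective {i} y z)
  ... | inj₂ x | inj₁ y | inj₁ z = b≢c (Next-functional {i} y z)
  ... | inj₂ x | inj₁ y | inj₂ z = a≢c (Next-injective {i} x z)

count≡0 : ∀ {m} {f : Fin m → Bool} → count f ≡ 0 → ∀ i → ¬ T (f i)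
count≡0 {suc m} {f} c≡0 i with f zero in eq
count≡0 {suc m} {f} () i       | true
count≡0 {suc m} {f} c≡0 zero    | false = subst T eq
count≡0 {suc m} {f} c≡0 (suc i) | false = count≡0 c≡0 i

count≢0 : ∀ {m} (f : Fin m → Bool) → count f ≢ 0 → ∃[ i ] T (f i)
count≢0 {zero}  f c≢0 = ⊥-elim (c≢0 refl)
count≢0 {suc m} f c≢0 with f zero in eq
... | true  = zero , subst T (sym eq) tt
... | false with count≢0 (λ i → f (suc i)) c≢0
...   | i , fi = suc i , fi

count≡1 : ∀ {m} {f : Fin m → Bool} → count f ≡ 1 → ∀ {i j} → T (f i) → T (f j) → i ≡ j
count≡1 {suc m} {f} c≡1 {zero}  {zero}  _  _  = refl
count≡1 {suc m} {f} c≡1 {zero}  {suc j} fi fj with f zero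
... | true  = ⊥-elim (count≡0 (suc-injective c≡1) j fj)
... | false = ⊥-elim fi
count≡1 {suc m} {f} c≡1 {suc i} {zero}  fi fj with f zero
... | true  = ⊥-elim (count≡0 (suc-injective c≡1) i fi)
... | false = ⊥-elim fj
count≡1 {suc m} {f} c≡1 {suc i} {suc j} fi fj with f zero
... | true  = ⊥-elim (count≡0 (suc-injective c≡1) i fi)
... | false = cong suc (count≡1 c≡1 fi fj)

fuel-step : ∀ {k} a b f → k ≤ a + suc f → 1 ≤ b → k ≤ a + b + f
fuel-step a b f k≤ 1≤b =
  ≤-trans k≤ (≤-trans (+-monoʳ-≤ a (+-monoˡ-≤ f 1≤b)) (≤-reflexive (sym (+-assoc a b f))))

module Graphs {n} (G : Graph n) where

  child⇒¬leaf : ∀ {c y} → Edge G c y → ¬ IsLeaf G c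
  child⇒¬leaf {c} c→y (_ , out≡0) = count≡0 {f = G c} out≡0 _ c→y

  two-parents⇒¬leaf : ∀ {c u w} → Edge G u c → Edge G w c → u ≢ w → ¬ IsLeaf G c
  two-parents⇒¬leaf {c} u→c w→c u≢w (in≡1 , _) = u≢w (count≡1 {f = λ v → G v c} in≡1 u→c w→c)

  two-neighbours⇒interior : ∀ {c y u} → Adj G c y → Adj G u c → y ≢ u → Interior G c
  two-neighbours⇒interior (inj₁ c→y) _           _   = child⇒¬leaf c→y
  two-neighbours⇒interior _           (inj₂ c→u) _   = child⇒¬leaf c→u
  two-neighbours⇒interior (inj₂ y→c) (inj₁ u→c) y≢u = two-parents⇒¬leaf y→c u→c y≢u

  adj? : ∀ u v → Dec (Adj G u v)
  adj? u v = T? (G u v) ⊎-dec T? (G v u)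

  adj-sym : ∀ {u v} → Adj G u v → Adj G v u
  adj-sym (inj₁ e) = inj₂ e
  adj-sym (inj₂ e) = inj₁ e

  -- An undirected walk from u to v; xs lists its vertices after u.
  data Walk : Fin n → Fin n → List (Fin n) → Set where
    []  : ∀ {u} → Walk u u []
    _∷_ : ∀ {u w v xs} → Adj G u w → Walk w v xs → Walk u v (w ∷ xs)

  _++ʷ_ : ∀ {u v w xs ys} → Walk u v xs → Walk v w ys → Walk u w (xs ++ ys)
  []      ++ʷ q = q
  (a ∷ p) ++ʷ q = a ∷ (p ++ʷ q)

  walk-split : ∀ xs {u w y ys} → Walk u w (xs ++ y ∷ ys) → Walk u y (xs ++ [ y ]) × Walk y w ys
  walk-split []       (a ∷ p) = a ∷ [] , p
  walk-split (x ∷ xs) (a ∷ p) = let p₁ , p₂ = walk-split xs p in a ∷ p₁ , p₂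

  walk-rotate : ∀ xs {a y ys} → Walk a a (xs ++ y ∷ ys) → Walk y y (ys ++ xs ++ [ y ])
  walk-rotate xs p = let p₁ , p₂ = walk-split xs p in p₂ ++ʷ p₁

  rotate-to : ∀ {a c ws} → Walk a a ws → c ∈ ws → ∃[ rs ] Walk c c rs × ws ↭ rs
  rotate-to w c∈ with ∈-∃++ c∈
  ... | p , s , refl = _ , walk-rotate p w , rotate-↭ p s

  closed-walk-arc : ∀ {c a b L} → Walk c c L → Unique L → a ∈ L → b ∈ L →
                    ∃[ s ] Walk b a s × Unique (b ∷ s) × (∀ {x} → x ∈ s → x ∈ L)
  closed-walk-arc w L! a∈ b∈ with rotate-to w a∈
  ... | rs , w′ , L↭rs with ∈-∃++ (∈-resp-↭ L↭rs b∈)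
  ...   | p , s , refl =
    s , proj₂ (walk-split p w′) , Unique-++⁻ʳ p (Unique-resp-↭ L↭rs L!) ,
    λ x∈ → ∈-resp-↭ (↭-sym L↭rs) (∈-++⁺ʳ p (there x∈))

  walk-end∈ : ∀ {u v xs} → Walk u v xs → u ≢ v → v ∈ xs
  walk-end∈ []      u≢v = ⊥-elim (u≢v refl)
  walk-end∈ (_ ∷ p) _   = end∈ p
    where
    end∈ : ∀ {w v xs} → Walk w v xs → v ∈ w ∷ xs
    end∈ []      = here refl
    end∈ (_ ∷ p) = there (end∈ p)

  walk-head : ∀ {u v x xs} → Walk u v (x ∷ xs) → Adj G u x
  walk-head (u~x ∷ _) = u~x

  lookup-step : ∀ {u v xs} → Walk u v xs → ∀ {i j} → toℕ j ≡ suc (toℕ i) →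
                Adj G (lookup xs i) (lookup xs j)
  lookup-step (_ ∷ (a ∷ _)) {zero}  {suc zero}    _ = a
  lookup-step (_ ∷ p)       {suc i} {suc j}       e = lookup-step p (suc-injective e)
  lookup-step (_ ∷ [])      {zero}  {suc ()}      _
  lookup-step (_ ∷ (_ ∷ _)) {zero}  {suc (suc _)} ()
  lookup-step (_ ∷ _)       {zero}  {zero}        ()
  lookup-step (_ ∷ _)       {suc _} {zero}        ()

  lookup-last : ∀ {u v xs} → Walk u v xs → ∀ {i} → suc (toℕ i) ≡ length xs → lookup xs i ≡ v
  lookup-last (_ ∷ [])      {zero}  _ = refl
  lookup-last (_ ∷ (_ ∷ _)) {zero}  ()
  lookup-last (_ ∷ p)       {suc i} e = lookup-last p (suc-injective e)

  applyUpTo-walk : (g : ℕ → Fin n) → ∀ m → (∀ t → t < m → Adj G (g t) (g (suc t))) →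
                   Walk (g 0) (g m) (applyUpTo (λ t → g (suc t)) m)
  applyUpTo-walk g zero    _   = []
  applyUpTo-walk g (suc m) adj =
    adj 0 (s≤s z≤n) ∷ applyUpTo-walk (λ t → g (suc t)) m (λ t t<m → adj (suc t) (s≤s t<m))

  _++ᴿ_ : ∀ {a b c} → Reach G a b → Reach G b c → Reach G a c
  here     ++ᴿ q = q
  step e p ++ᴿ q = step e (p ++ᴿ q)

  verts : ∀ {a b} → Reach G a b → List (Fin n)
  verts here               = []
  verts (step {w = w} _ r) = w ∷ verts r

  rverts : ∀ {a b} → Reach G a b → List (Fin n)
  rverts here               = []
  rverts (step {u = u} _ r) = rverts r ++ [ u ]

  length-verts-++ : ∀ {a b c} (p : Reach G a b) (q : Reach G b c) →
                    length (verts (p ++ᴿ q)) ≡ length (verts p) + length (verts q)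
  length-verts-++ here       q = refl
  length-verts-++ (step e p) q = cong suc (length-verts-++ p q)

  reach-walk : ∀ {a b} (r : Reach G a b) → Walk a b (verts r)
  reach-walk here       = []
  reach-walk (step e r) = inj₁ e ∷ reach-walk r

  reach-rwalk : ∀ {a b} (r : Reach G a b) → Walk b a (rverts r)
  reach-rwalk here       = []
  reach-rwalk (step e r) = reach-rwalk r ++ʷ (inj₂ e ∷ [])

  verts-split : ∀ {a b t} (r : Reach G a b) → t ∈ verts r → Reach G a t × Reach G t b
  verts-split (step e r) (here refl) = step e here , r
  verts-split (step e r) (there t∈)  = let p , q = verts-split r t∈ in step e p , q

  rverts-split : ∀ {a b t} (r : Reach G a b) → t ∈ rverts r → Reach G a t × Reach G t b
  rverts-split (step e r) t∈ with ∈-++⁻ (rverts r) t∈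
  ... | inj₁ t∈r         = let p , q = rverts-split r t∈r in step e p , q
  ... | inj₂ (here refl) = here , step e r

  last-edge : ∀ {a w b} (e : Edge G a w) (r : Reach G w b) →
              ∃[ q ] Edge G q b × q ∈ rverts (step e r)
  last-edge e here        = _ , e , here refl
  last-edge e (step e′ r) =
    let q , q→b , q∈ = last-edge e′ r in q , q→b , ∈-++⁺ˡ q∈

  infix 4 _∈ᶜ_ _∈ᶜ?_
  _∈ᶜ_ : Fin n → Cycle G → Set
  x ∈ᶜ C = _∈C_ G x C

  _∈ᶜ?_ : ∀ x C → Dec (x ∈ᶜ C)
  x ∈ᶜ? C = any? (λ i → Cycle.vtx C i ≟ x)

  isCycleRoot? : ∀ C v → Dec (IsCycleRoot G C v)
  isCycleRoot? C v = v ∈ᶜ? C ×-dec any? (λ w₁ → any? (λ w₂ →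
    ¬? (w₁ ≟ w₂) ×-dec T? (G v w₁) ×-dec T? (G v w₂) ×-dec w₁ ∈ᶜ? C ×-dec w₂ ∈ᶜ? C))

  module _ (C : Cycle G) where
    open Cycle C

    private
      position : ℕ → Fin (3 + k)
      position t = fromℕ< (m%n<n t (3 + k))

      position-< : ∀ {t} → t < 3 + k → toℕ (position t) ≡ t
      position-< t<m = trans (toℕ-fromℕ< _) (m<n⇒m%n≡m t<m)

      position-toℕ : ∀ i → position (toℕ i) ≡ i
      position-toℕ i = toℕ-injective (position-< (toℕ<n i))

      position-last : position (3 + k) ≡ zero
      position-last = toℕ-injective (trans (toℕ-fromℕ< _) (n%n≡0 (3 + k)))

      position-next : ∀ {t} → t < 3 + k → Next k (position t) (position (suc t))
      position-next {t} t<m =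
        trans (toℕ-fromℕ< _) (cong (λ x → suc x % (3 + k)) (sym (position-< t<m)))

      position-injective : ∀ {i j} → i < j → j < 3 + k → position (suc i) ≢ position (suc j)
      position-injective i<j j<m eq with Next-cases k (position-next j<m)
      ... | inj₁ e       = <-irrefl (suc-injective (trans 1+i≡ (trans e (cong suc (position-< j<m))))) i<j
        where 1+i≡ = trans (sym (position-< (≤-<-trans i<j j<m))) (cong toℕ eq)
      ... | inj₂ (_ , e) = 1+n≢0 (trans 1+i≡ e)
        where 1+i≡ = trans (sym (position-< (≤-<-trans i<j j<m))) (cong toℕ eq)

      corner : ℕ → Fin n
      corner t = vtx (position t)

    cycle-list : List (Fin n)
    cycle-list = applyUpTo (corner ∘ suc) (3 + k)

    cycle-list-walk : Walk (vtx zero) (vtx zero) cycle-list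
    cycle-list-walk = subst (λ v → Walk (vtx zero) v cycle-list) (cong vtx position-last)
      (applyUpTo-walk corner (3 + k) (λ t t<m → nb⇒adj _ _ (inj₁ (position-next t<m))))

    Unique-cycle-list : Unique cycle-list
    Unique-cycle-list =
      Unique.applyUpTo⁺₁ _ (3 + k) (λ i<j j<m eq → position-injective i<j j<m (inj _ _ eq))

    ∈-cycle-list⁻ : ∀ {x} → x ∈ cycle-list → x ∈ᶜ C
    ∈-cycle-list⁻ x∈ with ∈-applyUpTo⁻ (corner ∘ suc) x∈
    ... | t , _ , refl = position (suc t) , refl

    ∈-cycle-list⁺ : ∀ {x} → x ∈ᶜ C → x ∈ cycle-list
    ∈-cycle-list⁺ (zero  , refl) =
      subst (_∈ cycle-list) (cong vtx position-last) (∈-applyUpTo⁺ (corner ∘ suc) ≤-refl)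
    ∈-cycle-list⁺ (suc i , refl) =
      subst (_∈ cycle-list) (cong vtx (position-toℕ (suc i)))
        (∈-applyUpTo⁺ (corner ∘ suc) (<⇒≤ (toℕ<n (suc i))))

    cycle-arc : ∀ {a b} → a ∈ᶜ C → b ∈ᶜ C →
                ∃[ s ] Walk a b s × Unique (a ∷ s) × (∀ {x} → x ∈ s → x ∈ᶜ C)
    cycle-arc aC bC
      with closed-walk-arc cycle-list-walk Unique-cycle-list (∈-cycle-list⁺ bC) (∈-cycle-list⁺ aC)
    ... | s , w , a∷s! , s⊆ = s , w , a∷s! , λ x∈ → ∈-cycle-list⁻ (s⊆ x∈)

  record IsCircuit (a : Fin n) (ws : List (Fin n)) : Set where
    constructor circuit
    field
      walk   : Walk a a ws
      unique : Unique ws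
      long   : 3 ≤ length ws

  closed-walk-interior : ∀ {c rs} → Walk c c rs → Unique rs → 3 ≤ length rs → Interior G c
  closed-walk-interior {rs = y ∷ x₁ ∷ x₂ ∷ xs} (c~y ∷ w) (y∉ ∷ _) _ with last-two x₁ x₂ xs
  ... | M , u , _ , eq with walk-split M (subst (Walk y _) eq w)
  ...   | _ , (u~c ∷ []) = two-neighbours⇒interior c~y u~c
    (All.lookup y∉ (subst (u ∈_) (sym eq) (∈-++⁺ʳ M (here refl))))
  closed-walk-interior {rs = []}              _ _ ()
  closed-walk-interior {rs = _ ∷ []}          _ _ (s≤s ())
  closed-walk-interior {rs = _ ∷ _ ∷ []}      _ _ (s≤s (s≤s ()))

  circuit-interior : ∀ {a ws c} → IsCircuit a ws → c ∈ ws → Interior G c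
  circuit-interior (circuit w ws! long) c∈ with rotate-to w c∈
  ... | _ , w′ , ws↭rs =
    closed-walk-interior w′ (Unique-resp-↭ ws↭rs ws!) (subst (3 ≤_) (↭-length ws↭rs) long)

  -- An edge between two vertices that are not consecutive on the closed walk ws.
  record Chord (ws : List (Fin n)) : Set where
    field
      before between after : List (Fin n)
      x y              : Fin n
      split            : ws ≡ before ++ x ∷ between ++ y ∷ after
      x~y              : Adj G x y
      between-nonempty : 1 ≤ length between
      outside-nonempty : 1 ≤ length (before ++ after)

    outer : List (Fin n)
    outer = before ++ x ∷ y ∷ after

    inner : List (Fin n)
    inner = x ∷ between ++ [ y ]

  module _ {a ws} (W : IsCircuit a ws) (ch : Chord ws) where
    open IsCircuit W
    open Chord ch

    private
      ws↭outer : ws ↭ outer ++ between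
      ws↭outer = subst (_↭ outer ++ between) (sym split) (drop-between-↭ before between after)

      ws↭inner : ws ↭ inner ++ before ++ after
      ws↭inner =
        subst (_↭ inner ++ before ++ after) (sym split) (extract-between-↭ before between after)

      walk-to-x = walk-split before (subst (Walk a a) split walk)
      walk-x-to-y = walk-split between (proj₂ walk-to-x)

    outer-circuit : IsCircuit a outer
    outer-circuit = circuit
      (subst (Walk a a) (++-assoc before [ x ] (y ∷ after))
        (proj₁ walk-to-x ++ʷ (x~y ∷ proj₂ walk-x-to-y)))
      (Unique-++⁻ˡ outer (Unique-resp-↭ ws↭outer unique))
      (subst (3 ≤_) (↭-length outer↭) (s≤s (s≤s outside-nonempty)))
      where
      outer↭ : x ∷ y ∷ before ++ after ↭ outer
      outer↭ = ↭-sym (↭-trans (++-comm before (x ∷ y ∷ after))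
                 (↭-prep x (↭-prep y (++-comm after before))))

    inner-circuit : IsCircuit y inner
    inner-circuit = circuit
      (adj-sym x~y ∷ proj₁ walk-x-to-y)
      (Unique-++⁻ˡ inner (Unique-resp-↭ ws↭inner unique))
      (s≤s (subst (2 ≤_) (sym (length-++ between)) (+-monoˡ-≤ 1 between-nonempty)))

    outer-shorter : length outer < length ws
    outer-shorter = subst (length outer <_) (sym (trans (↭-length ws↭outer) (length-++ outer)))
      (m<m+n (length outer) between-nonempty)

    inner-shorter : length inner < length ws
    inner-shorter = subst (length inner <_) (sym (trans (↭-length ws↭inner) (length-++ inner)))
      (m<m+n (length inner) outside-nonempty)

    chord-cover : ∀ {w} → w ∈ ws → w ∈ outer ⊎ w ∈ inner
    chord-cover w∈ with ∈-++⁻ outer (∈-resp-↭ ws↭outer w∈)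
    ... | inj₁ w∈outer   = inj₁ w∈outer
    ... | inj₂ w∈between = inj₂ (there (∈-++⁺ˡ w∈between))

  index-chord : ∀ v₀ v₁ v₂ rest → let ws = v₀ ∷ v₁ ∷ v₂ ∷ rest in
                ∀ {i j} → toℕ i < toℕ j → Adj G (lookup ws i) (lookup ws j) →
                ¬ CycNb (length rest) i j → Chord ws
  index-chord v₀ v₁ v₂ rest {i} {j} i<j x~y ¬nb with split-at-indices (v₀ ∷ v₁ ∷ v₂ ∷ rest) i<j
  ... | p , [] , s , eq , len₁ , len₂ =
    ⊥-elim (¬nb (inj₁ (Next-step (length rest) {i} {j}
      (trans (sym len₂) (cong suc (trans (+-identityʳ _) len₁))))))
  ... | [] , q@(_ ∷ _) , [] , eq , len₁ , len₂ =
    ⊥-elim (¬nb (inj₂ (Next-wrap (length rest) {j} {i} (trans (sym len₂) j≡last) (sym len₁))))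
    where
    j≡last : suc (length q) ≡ 2 + length rest
    j≡last = sym (trans (suc-injective (cong length eq)) (trans (length-++ q) (+-comm (length q) 1)))
  ... | p@(_ ∷ _) , q@(_ ∷ _) , s , eq , _ , _ = record
    { before = p ; between = q ; after = s ; split = eq ; x~y = x~y
    ; between-nonempty = s≤s z≤n ; outside-nonempty = s≤s z≤n }
  ... | [] , q@(_ ∷ _) , s@(_ ∷ _) , eq , _ , _ = record
    { before = [] ; between = q ; after = s ; split = eq ; x~y = x~y
    ; between-nonempty = s≤s z≤n ; outside-nonempty = s≤s z≤n }

  chordless-cycle : ∀ {a} v₀ v₁ v₂ rest → let ws = v₀ ∷ v₁ ∷ v₂ ∷ rest in
                    Walk a a ws → Unique ws →
                    (∀ i j → Adj G (lookup ws i) (lookup ws j) → CycNb (length rest) i j) → Cycle G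
  chordless-cycle {a} v₀ v₁ v₂ rest w ws! chordless = record
    { k = length rest ; vtx = lookup ws ; inj = λ _ _ → lookup-injective ws!
    ; adj⇒nb = chordless ; nb⇒adj = nb⇒adj }
    where
    ws = v₀ ∷ v₁ ∷ v₂ ∷ rest

    next⇒adj : ∀ {i j} → Next (length rest) i j → Adj G (lookup ws i) (lookup ws j)
    next⇒adj {i} {j} next with Next-cases (length rest) {i} {j} next
    ... | inj₁ j≡1+i          = lookup-step w j≡1+i
    ... | inj₂ (i≡last , j≡0) = subst₂ (Adj G) (sym (lookup-last w (cong suc i≡last)))
                                  (cong (lookup ws) (sym (toℕ-injective j≡0))) (walk-head w)

    nb⇒adj : ∀ i j → CycNb (length rest) i j → Adj G (lookup ws i) (lookup ws j)
    nb⇒adj i j (inj₁ next) = next⇒adj {i} {j} next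
    nb⇒adj i j (inj₂ next) = adj-sym (next⇒adj {j} {i} next)

module Network {n} {G : Graph n} (N : PhyloNetwork G) where
  open Graphs G
  open PhyloNetwork N

  reach-antisym : ∀ {a b} → Reach G a b → Reach G b a → a ≡ b
  reach-antisym here       _ = refl
  reach-antisym (step e r) q = ⊥-elim (acyclic _ _ e (r ++ᴿ q))

  verts-≢start : ∀ {a b t} (r : Reach G a b) → t ∈ verts r → t ≢ a
  verts-≢start (step e r) (here refl) refl = acyclic _ _ e here
  verts-≢start (step e r) (there t∈)  refl = acyclic _ _ e (proj₁ (verts-split r t∈))

  rverts-≢end : ∀ {a b t} (r : Reach G a b) → t ∈ rverts r → t ≢ b
  rverts-≢end (step e r) t∈ t≡b with ∈-++⁻ (rverts r) t∈
  ... | inj₁ t∈r         = rverts-≢end r t∈r t≡b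
  ... | inj₂ (here refl) = acyclic _ _ e (subst (Reach G _) (sym t≡b) r)

  verts-nonempty : ∀ {a b} (r : Reach G a b) → b ≢ a → 1 ≤ length (verts r)
  verts-nonempty here       b≢a = ⊥-elim (b≢a refl)
  verts-nonempty (step _ _) _   = s≤s z≤n

  Unique-start∷verts : ∀ {a b} (r : Reach G a b) → Unique (a ∷ verts r)
  Unique-start∷verts here       = [] ∷ []
  Unique-start∷verts (step e r) =
    All.tabulate (λ t∈ → ≢-sym (verts-≢start (step e r) t∈)) ∷ Unique-start∷verts r

  Unique-verts : ∀ {a b} (r : Reach G a b) → Unique (verts r)
  Unique-verts r with Unique-start∷verts r
  ... | _ ∷ verts! = verts!

  Unique-rverts : ∀ {a b} (r : Reach G a b) → Unique (rverts r)
  Unique-rverts here       = []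
  Unique-rverts (step e r) = Unique.++⁺ (Unique-rverts r) ([] ∷ [])
    λ { (a∈ , here refl) → acyclic _ _ e (proj₁ (rverts-split r a∈)) }

  verts-length<n : ∀ {a b} (r : Reach G a b) → length (verts r) < n
  verts-length<n r = injective⇒≤ (lookup-injective (Unique-start∷verts r))

  reach? : ∀ u v → Dec (Reach G u v)
  reach? u v = map′ (sound n) (λ r → complete n r (<⇒≤ (verts-length<n r))) (bounded? n u v)
    where
    Bounded : ℕ → Fin n → Fin n → Set
    Bounded zero    x y = x ≡ y
    Bounded (suc f) x y = x ≡ y ⊎ ∃[ w ] Edge G x w × Bounded f w y

    bounded? : ∀ f x y → Dec (Bounded f x y)
    bounded? zero    x y = x ≟ y
    bounded? (suc f) x y = x ≟ y ⊎-dec any? (λ w → T? (G x w) ×-dec bounded? f w y)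

    sound : ∀ f {x y} → Bounded f x y → Reach G x y
    sound zero    refl              = here
    sound (suc f) (inj₁ refl)       = here
    sound (suc f) (inj₂ (_ , e , b)) = step e (sound f b)

    complete : ∀ f {x y} (r : Reach G x y) → length (verts r) ≤ f → Bounded f x y
    complete zero    here       _          = refl
    complete (suc f) here       _          = inj₁ refl
    complete (suc f) (step e r) (s≤s r≤f) = inj₂ (_ , e , complete f r r≤f)

  module _ {P : Fin n → Set} (P? : ∀ x → Dec (P x)) where

    reach-maximal : ∀ {x} → P x → ∃[ y ] P y × Reach G x y × (∀ {t} → P t → Reach G y t → t ≡ y)
    reach-maximal {x} px = search n px here ≤-refl
      where
      search : ∀ f {y} → P y → (w : Reach G x y) → n ≤ length (verts w) + f →
               ∃[ y ] P y × Reach G x y × (∀ {t} → P t → Reach G y t → t ≡ y)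
      search zero    _ w n≤ = ⊥-elim (<⇒≱ (verts-length<n w) (subst (n ≤_) (+-identityʳ _) n≤))
      search (suc f) {y} py w n≤ with any? (λ t → P? t ×-dec reach? y t ×-dec ¬? (t ≟ y))
      ... | yes (t , pt , y↝t , t≢y) =
        search f pt (w ++ᴿ y↝t) (subst (n ≤_) (cong (_+ f) (sym (length-verts-++ w y↝t)))
          (fuel-step _ _ f n≤ (verts-nonempty y↝t t≢y)))
      ... | no ¬above = y , py , w , λ pt y↝t →
        decidable-stable (_ ≟ y) (λ t≢y → ¬above (_ , pt , y↝t , t≢y))

    reach-minimal : ∀ {x} → P x → ∃[ y ] P y × Reach G y x × (∀ {t} → P t → Reach G t y → t ≡ y)
    reach-minimal {x} px = search n px here ≤-refl
      where
      search : ∀ f {y} → P y → (w : Reach G y x) → n ≤ length (verts w) + f →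
               ∃[ y ] P y × Reach G y x × (∀ {t} → P t → Reach G t y → t ≡ y)
      search zero    _ w n≤ = ⊥-elim (<⇒≱ (verts-length<n w) (subst (n ≤_) (+-identityʳ _) n≤))
      search (suc f) {y} py w n≤ with any? (λ t → P? t ×-dec reach? t y ×-dec ¬? (t ≟ y))
      ... | yes (t , pt , t↝y , t≢y) =
        search f pt (t↝y ++ᴿ w) (subst (n ≤_) (cong (_+ f) length-eq)
          (fuel-step _ _ f n≤ (verts-nonempty t↝y (≢-sym t≢y))))
        where
        length-eq = trans (+-comm (length (verts w)) _) (sym (length-verts-++ t↝y w))
      ... | no ¬below = y , py , w , λ pt t↝y →
        decidable-stable (_ ≟ y) (λ t≢y → ¬below (_ , pt , t↝y , t≢y))

  root-reaches : ∀ v → Reach G root v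
  root-reaches v with reach-minimal {P = λ _ → ⊤} (λ _ → yes tt) {v} tt
  ... | y , _ , y↝v , minimal with indeg G y ℕ.≟ 0
  ...   | yes indeg≡0 = subst (λ r → Reach G r v) (rootUniq y indeg≡0) y↝v
  ...   | no indeg≢0  =
    let u , u→y = count≢0 (λ u → G u y) indeg≢0
    in ⊥-elim (noLoops y (subst (λ t → Edge G t y) (minimal tt (step u→y here)) u→y))

  record Peak (u v : Fin n) : Set where
    field
      vs      : List (Fin n)
      walk    : Walk u v vs
      unique  : Unique vs
      parent  : Fin n
      parent∈ : parent ∈ vs
      parent→ : Edge G parent u
      above   : ∀ {x} → x ∈ vs → (Reach G x u × x ≢ u) ⊎ Reach G x v

  peak : ∀ {u v} → ¬ Reach G u v → Peak u v
  peak {u} {v} ¬u↝v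
    with reach-maximal (λ t → reach? t u ×-dec reach? t v) (root-reaches u , root-reaches v)
  ... | _ , (here , z↝v) , _ , _ = ⊥-elim (¬u↝v z↝v)
  ... | _ , (z↝u@(step e r) , z↝v) , _ , maximal with last-edge e r
  ...   | q , q→u , q∈ = record
    { vs      = rverts z↝u ++ verts z↝v
    ; walk    = reach-rwalk z↝u ++ʷ reach-walk z↝v
    ; unique  = Unique.++⁺ (Unique-rverts z↝u) (Unique-verts z↝v) disjoint
    ; parent  = q
    ; parent∈ = ∈-++⁺ˡ q∈
    ; parent→ = q→u
    ; above   = above
    }
    where
    disjoint : ∀ {x} → ¬ (x ∈ rverts z↝u × x ∈ verts z↝v)
    disjoint (x∈₁ , x∈₂) = let z↝x , x↝v = verts-split z↝v x∈₂ in
      verts-≢start z↝v x∈₂ (maximal (proj₂ (rverts-split z↝u x∈₁) , x↝v) z↝x)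

    above : ∀ {x} → x ∈ rverts z↝u ++ verts z↝v → (Reach G x u × x ≢ u) ⊎ Reach G x v
    above x∈ with ∈-++⁻ (rverts z↝u) x∈
    ... | inj₁ x∈₁ = inj₁ (proj₂ (rverts-split z↝u x∈₁) , rverts-≢end z↝u x∈₁)
    ... | inj₂ x∈₂ = inj₂ (proj₂ (verts-split z↝v x∈₂))

  record Valley (u v : Fin n) : Set where
    field
      vs     : List (Fin n)
      walk   : Walk u v vs
      unique : Unique vs
      below  : ∀ {x} → x ∈ vs → (Reach G u x × x ≢ u) ⊎ Reach G v x

  valley : ∀ {u v x} → Reach G u x → Reach G v x → Valley u v
  valley {u} {v} u↝x v↝x with reach-minimal (λ t → reach? u t ×-dec reach? v t) (u↝x , v↝x)
  ... | _ , (u↝m , v↝m) , _ , minimal = record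
    { vs     = verts u↝m ++ rverts v↝m
    ; walk   = reach-walk u↝m ++ʷ reach-rwalk v↝m
    ; unique = Unique.++⁺ (Unique-verts u↝m) (Unique-rverts v↝m) disjoint
    ; below  = below
    }
    where
    disjoint : ∀ {x} → ¬ (x ∈ verts u↝m × x ∈ rverts v↝m)
    disjoint (x∈₁ , x∈₂) = let u↝x , x↝m = verts-split u↝m x∈₁ in
      rverts-≢end v↝m x∈₂ (minimal (u↝x , proj₁ (rverts-split v↝m x∈₂)) x↝m)

    below : ∀ {x} → x ∈ verts u↝m ++ rverts v↝m → (Reach G u x × x ≢ u) ⊎ Reach G v x
    below x∈ with ∈-++⁻ (verts u↝m) x∈
    ... | inj₁ x∈₁ = inj₁ (proj₁ (verts-split u↝m x∈₁) , verts-≢start u↝m x∈₁)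
    ... | inj₂ x∈₂ = inj₂ (proj₁ (rverts-split v↝m x∈₂))

  ¬adj-self : ∀ {u} → ¬ Adj G u u
  ¬adj-self (inj₁ e) = noLoops _ e
  ¬adj-self (inj₂ e) = noLoops _ e

  chordless-or-chord : ∀ k (f : Fin (3 + k) → Fin n) →
    (∀ i j → Adj G (f i) (f j) → CycNb k i j) ⊎
    (∃[ i ] ∃[ j ] toℕ i < toℕ j × Adj G (f i) (f j) × ¬ CycNb k i j)
  chordless-or-chord k f with any? (λ i → any? (λ j → adj? (f i) (f j) ×-dec ¬? (CycNb? k i j)))
  ... | no ¬chord =
    inj₁ λ i j i~j → decidable-stable (CycNb? k i j) (λ ¬nb → ¬chord (i , j , i~j , ¬nb))
  ... | yes (i , j , i~j , ¬nb) with <-cmp (toℕ i) (toℕ j)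
  ...   | tri< i<j _ _ = inj₂ (i , j , i<j , i~j , ¬nb)
  ...   | tri≈ _ i≡j _ =
    ⊥-elim (¬adj-self (subst (λ t → Adj G (f i) (f t)) (sym (toℕ-injective i≡j)) i~j))
  ...   | tri> _ _ j<i = inj₂ (j , i , j<i , adj-sym i~j , ¬nb ∘ swap)

  RootAbove : Cycle G → Cycle G → Set
  RootAbove C D = ∃[ r₁ ] ∃[ r₂ ] IsCycleRoot G C r₁ × IsCycleRoot G D r₂ × Reach G r₁ r₂

  root-above? : ∀ C D → Dec (RootAbove C D)
  root-above? C D =
    any? (λ r₁ → any? (λ r₂ → isCycleRoot? C r₁ ×-dec isCycleRoot? D r₂ ×-dec reach? r₁ r₂))

  module _ (L1 : Level1 G) where

    circuit⊆cycle : ∀ C {a ws} → IsCircuit a ws → ∀ {c} → c ∈ ws → c ∈ᶜ C → ∀ {w} → w ∈ ws → w ∈ᶜ C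
    circuit⊆cycle C {ws = ws} W = shrink (length ws) W ≤-refl
      where
      shrink : ∀ F {a ws} → IsCircuit a ws → length ws ≤ F →
               ∀ {c} → c ∈ ws → c ∈ᶜ C → ∀ {w} → w ∈ ws → w ∈ᶜ C
      shrink _       {ws = []}         (circuit _ _ ())
      shrink _       {ws = _ ∷ []}     (circuit _ _ (s≤s ()))
      shrink _       {ws = _ ∷ _ ∷ []} (circuit _ _ (s≤s (s≤s ())))
      shrink zero    {ws = _ ∷ _ ∷ _ ∷ _} _ ()
      shrink (suc F) {ws = v₀ ∷ v₁ ∷ v₂ ∷ rest} W len {c} c∈ cC {w} w∈
        with chordless-or-chord (length rest) (lookup (v₀ ∷ v₁ ∷ v₂ ∷ rest))
      ... | inj₁ chordless = proj₂ (L1 C E c (circuit-interior W c∈) cC (∈E c∈) w) (∈E w∈)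
        where
        E = chordless-cycle v₀ v₁ v₂ rest (IsCircuit.walk W) (IsCircuit.unique W) chordless
        ∈E : ∀ {x} → x ∈ v₀ ∷ v₁ ∷ v₂ ∷ rest → x ∈ᶜ E
        ∈E x∈ = index x∈ , sym (lookup-index x∈)
      ... | inj₂ (_ , _ , i<j , i~j , ¬nb) = by-cases (x ∈ᶜ? C)
        where
        ch = index-chord v₀ v₁ v₂ rest i<j i~j ¬nb
        open Chord ch
        on-outer : ∀ {c} → c ∈ outer → c ∈ᶜ C → ∀ {w} → w ∈ outer → w ∈ᶜ C
        on-outer = shrink F (outer-circuit W ch) (≤-pred (≤-trans (outer-shorter W ch) len))
        on-inner : ∀ {c} → c ∈ inner → c ∈ᶜ C → ∀ {w} → w ∈ inner → w ∈ᶜ C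
        on-inner = shrink F (inner-circuit W ch) (≤-pred (≤-trans (inner-shorter W ch) len))
        x∈outer : x ∈ outer
        x∈outer = ∈-++⁺ʳ before (here refl)
        by-cases : Dec (x ∈ᶜ C) → w ∈ᶜ C
        by-cases (yes xC)  = [ on-outer x∈outer xC , on-inner (here refl) xC ]′ (chord-cover W ch w∈)
        by-cases (no x∉C)  = ⊥-elim (x∉C ([ (λ c∈ → on-outer c∈ cC x∈outer)
                                           , (λ c∈ → on-inner c∈ cC (here refl)) ]′ (chord-cover W ch c∈)))

    cycle-has-no-ear : ∀ C {a b ys y} → a ∈ᶜ C → b ∈ᶜ C → a ≢ b → Walk a b ys → Unique ys →
                       (∀ {t} → t ∈ ys → t ≢ b → ¬ t ∈ᶜ C) → y ∈ ys → ¬ y ∈ᶜ C → ⊥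
    cycle-has-no-ear C {a} {b} {ys} {y} aC bC a≢b w ys! outside y∈ y∉C with cycle-arc C bC aC
    ... | s , arc , b∉s ∷ s! , s⊆C =
      y∉C (circuit⊆cycle C (circuit (w ++ʷ arc) (Unique.++⁺ ys! s! disjoint) long)
             (∈-++⁺ˡ b∈ys) bC (∈-++⁺ˡ y∈))
      where
      b∈ys : b ∈ ys
      b∈ys = walk-end∈ w a≢b

      disjoint : ∀ {t} → ¬ (t ∈ ys × t ∈ s)
      disjoint (t∈ys , t∈s) = outside t∈ys (λ t≡b → All.lookup b∉s t∈s (sym t≡b)) (s⊆C t∈s)

      long : 3 ≤ length (ys ++ s)
      long = distinct⇒3≤length (∈-++⁺ˡ y∈) (∈-++⁺ˡ b∈ys) (∈-++⁺ʳ ys (walk-end∈ arc (≢-sym a≢b)))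
        (λ { refl → y∉C bC }) (λ { refl → y∉C aC }) (≢-sym a≢b)

    root-parent-outside : ∀ C {s q} → IsCycleRoot G C s → Edge G q s → ¬ q ∈ᶜ C
    root-parent-outside C
      ((i , refl) , _ , _ , w₁≢w₂ , s→w₁ , s→w₂ , (a , refl) , (b , refl)) q→s (c , refl) =
      CycNb-at-most-two k {i} {a} {b} {c}
        (adj⇒nb i a (inj₁ s→w₁)) (adj⇒nb i b (inj₁ s→w₂)) (adj⇒nb i c (inj₂ q→s))
        (λ a≡b → w₁≢w₂ (cong vtx a≡b))
        (λ { refl → acyclic _ _ s→w₁ (step q→s here) })
        (λ { refl → acyclic _ _ s→w₂ (step q→s here) })
      where open Cycle C

    -- If t ≢ s, a maximal such vertex u yields an ear from s up to u: its inner vertices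
    -- avoid C by maximality, and its first step goes from s to a parent outside C.
    cycle-root-minimal : ∀ C {s t} → IsCycleRoot G C s → t ∈ᶜ C → Reach G t s → t ≡ s
    cycle-root-minimal C {s} {t} root tC t↝s with t ≟ s
    ... | yes t≡s = t≡s
    ... | no t≢s
      with reach-maximal (λ x → x ∈ᶜ? C ×-dec ¬? (x ≟ s) ×-dec reach? x s) (tC , t≢s , t↝s)
    ...   | _ , (_ , u≢s , here) , _ , _ = ⊥-elim (u≢s refl)
    ...   | u , (uC , u≢s , u↝s@(step e r)) , _ , maximal with last-edge e r
    ...     | q , q→s , q∈ = ⊥-elim (cycle-has-no-ear C (proj₁ root) uC (≢-sym u≢s)
                (reach-rwalk u↝s) (Unique-rverts u↝s) outside q∈ (root-parent-outside C root q→s))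
      where
      outside : ∀ {x} → x ∈ rverts u↝s → x ≢ u → ¬ x ∈ᶜ C
      outside x∈ x≢u xC = let u↝x , x↝s = rverts-split u↝s x∈ in
        x≢u (maximal (xC , rverts-≢end u↝s x∈ , x↝s) u↝x)

    cycle-root-unique : ∀ C {s₁ s₂} → IsCycleRoot G C s₁ → IsCycleRoot G C s₂ → s₁ ≡ s₂
    cycle-root-unique C {s₁} {s₂} root₁ root₂ with reach? s₁ s₂ | reach? s₂ s₁
    ... | yes s₁↝s₂ | _         = cycle-root-minimal C root₂ (proj₁ root₁) s₁↝s₂
    ... | no _      | yes s₂↝s₁ = sym (cycle-root-minimal C root₁ (proj₁ root₂) s₂↝s₁)
    ... | no ¬s₁↝s₂ | no _      =
      ⊥-elim (cycle-has-no-ear C (proj₁ root₁) (proj₁ root₂) (λ { refl → ¬s₁↝s₂ here })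
                walk unique outside parent∈ (root-parent-outside C root₁ parent→))
      where
      open Peak (peak ¬s₁↝s₂)
      outside : ∀ {x} → x ∈ vs → x ≢ s₂ → ¬ x ∈ᶜ C
      outside x∈ x≢s₂ xC with above x∈
      ... | inj₁ (x↝s₁ , x≢s₁) = x≢s₁ (cycle-root-minimal C root₁ xC x↝s₁)
      ... | inj₂ x↝s₂          = x≢s₂ (cycle-root-minimal C root₂ xC x↝s₂)

    -- If r and v were incomparable, a peak r ⇝ v and a valley v ⇝ r would close up to a
    -- circuit through r and its parent, which lies outside C.
    cycle-root-comparable : ∀ C {r v x} → IsCycleRoot G C r → Reach G r x → Reach G v x →
                            Reach G r v ⊎ Reach G v r
    cycle-root-comparable C {r} {v} root r↝x v↝x with reach? r v | reach? v r
    ... | yes r↝v | _       = inj₁ r↝v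
    ... | no _    | yes v↝r = inj₂ v↝r
    ... | no ¬r↝v | no ¬v↝r = ⊥-elim (root-parent-outside C root P.parent→
          (circuit⊆cycle C (circuit (P.walk ++ʷ V.walk) (Unique.++⁺ P.unique V.unique disjoint) long)
             r∈ (proj₁ root) (∈-++⁺ˡ P.parent∈)))
      where
      module P = Peak (peak ¬r↝v)
      module V = Valley (valley v↝x r↝x)

      disjoint : ∀ {t} → ¬ (t ∈ P.vs × t ∈ V.vs)
      disjoint (t∈₁ , t∈₂) with P.above t∈₁ | V.below t∈₂
      ... | inj₁ (t↝r , _)   | inj₁ (v↝t , _)   = ¬v↝r (v↝t ++ᴿ t↝r)
      ... | inj₁ (t↝r , t≢r) | inj₂ r↝t         = t≢r (reach-antisym t↝r r↝t)
      ... | inj₂ t↝v         | inj₁ (v↝t , t≢v) = t≢v (reach-antisym t↝v v↝t)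
      ... | inj₂ t↝v         | inj₂ r↝t         = ¬r↝v (r↝t ++ᴿ t↝v)

      r≢v : r ≢ v
      r≢v refl = ¬r↝v here

      r∈ : r ∈ P.vs ++ V.vs
      r∈ = ∈-++⁺ʳ P.vs (walk-end∈ V.walk (≢-sym r≢v))

      long : 3 ≤ length (P.vs ++ V.vs)
      long = distinct⇒3≤length r∈ (∈-++⁺ˡ P.parent∈) (∈-++⁺ˡ (walk-end∈ P.walk r≢v))
        (λ r≡q → noLoops _ (subst (λ q → Edge G q r) (sym r≡q) P.parent→)) r≢v
        (λ q≡v → ¬v↝r (subst (λ q → Reach G q r) q≡v (step P.parent→ here)))

    R-⊆ : ∀ C D → RootAbove C D → ∀ {x} → R G D x → R G C x
    R-⊆ C D (r₁ , r₂ , root₁ , root₂ , r₁↝r₂) (leaf , r , root , r↝x) =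
      leaf , r₁ , root₁ , r₁↝r₂ ++ᴿ subst (λ t → Reach G t _) (cycle-root-unique D root root₂) r↝x

    R-disjoint : ∀ C D → ¬ RootAbove C D → ¬ RootAbove D C → ∀ {x} → ¬ (R G C x × R G D x)
    R-disjoint C D ¬CD ¬DC ((_ , r₁ , root₁ , r₁↝x) , (_ , r₂ , root₂ , r₂↝x))
      with cycle-root-comparable C root₁ r₁↝x r₂↝x
    ... | inj₁ r₁↝r₂ = ¬CD (r₁ , r₂ , root₁ , root₂ , r₁↝r₂)
    ... | inj₂ r₂↝r₁ = ¬DC (r₂ , r₁ , root₂ , root₁ , r₂↝r₁)

lemma7 : ∀ {n} (G : Graph n) → PhyloNetwork G → Level1 G → Cycle G →
    ∀ (C D : Cycle G) → Cap∈ (R G C) (R G D)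
lemma7 G N L1 _ C D = hierarchy (root-above? C D) (root-above? D C)
  where
  open Network N
  hierarchy : Dec (RootAbove C D) → Dec (RootAbove D C) → Cap∈ (R G C) (R G D)
  hierarchy (yes CD) _        = inj₂ (inj₁ λ _ → proj₂ , λ d → R-⊆ L1 C D CD d , d)
  hierarchy (no _)   (yes DC) = inj₁ λ _ → proj₁ , λ c → c , R-⊆ L1 D C DC c
  hierarchy (no ¬CD) (no ¬DC) = inj₂ (inj₂ λ _ → R-disjoint L1 C D ¬CD ¬DC)
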